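{- Let $q>2$ and $n\ge1$ be integers with $n\equiv q \pmod{q^2}$, and let $\lambda$ be a positive integer. Then every $\lambda$-fold $1$-packing $C$ in $H(n,q)$ with minimum distance $2$ satisfies $$|C| \le \frac{\lambda q^n}{n(q-1)+q}.$$
   Context: $H(n,q)$ is the Hamming graph on words of length $n$ over $\{0,1,\ldots,q-1\}$, two words adjacent iff they differ in exactly one position. A $\lambda$-fold $1$-packing is a multiset $C$ of vertices such that every vertex of $H(n,q)$ is at Hamming distance at most $1$ from at most $\lambda$ elements of $C$, counted with multiplicity. Minimum distance $2$ means that the Hamming distance between any two distinct elements of $C$ (in particular, no element is repeated) is at least $2$, with $2$ attained. -}

module Defs where

open import Data.Nat using (ℕ; zero; suc; _+_; _≤_; _≤?_)
open import Data.Fin using (Fin)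
open import Data.Fin.Properties using (_≟_)
open import Data.Vec using (Vec; []; _∷_)
open import Data.List using (List; length; filter; lookup)
open import Data.Bool using (if_then_else_)
open import Data.Product using (∃; _×_; Σ)
open import Relation.Nullary using (¬_; does)
open import Relation.Binary.PropositionalEquality using (_≡_)

Word : ℕ → ℕ → Set
Word n q = Vec (Fin q) n

hdist : ∀ {n q} → Word n q → Word n q → ℕ
hdist []       []       = 0
hdist (x ∷ xs) (y ∷ ys) = (if does (x ≟ y) then 0 else 1) + hdist xs ys

-- A multiset of vertices, represented as a list (multiplicity = number of occurrences).
Code : ℕ → ℕ → Set
Code n q = List (Word n q)

ballCount : ∀ {n q} → Word n q → Code n q → ℕ
ballCount x C = length (filter (λ c → hdist x c ≤? 1) C)

IsPacking : ∀ {n q} → ℕ → Code n q → Set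
IsPacking {n} {q} lam C = (x : Word n q) → ballCount x C ≤ lam

-- Minimum distance exactly 2: any two entries at distinct positions of the list
-- (hence distinct elements; no repetitions) are at distance ≥ 2, and 2 is attained.
HasMinDist2 : ∀ {n q} → Code n q → Set
HasMinDist2 C =
  ((i j : Fin (length C)) → ¬ i ≡ j → 2 ≤ hdist (lookup C i) (lookup C j))
  × ∃ λ (i : Fin (length C)) → ∃ λ (j : Fin (length C)) →
      (¬ i ≡ j) × (hdist (lookup C i) (lookup C j) ≡ 2)

-- Delsarte's method with a positive semidefinite kernel. For φ : ℕ → ℤ put
-- κ φ x y = ∑ᵤ φ (n − wt u) χᵤ (x − y) over the characters u of ℤ_qⁿ. If φ ≥ 0 then κ φ is
-- positive semidefinite, and its trivial character alone gives ∑_{c,c′ ∈ C} κ φ c c′ ≥ φ(n) |C|².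
-- Take φ = ψ with ψ(t) = (qt − n)(qt − n + q), nonnegative at integers because q ∣ n (which is
-- what n ≡ q (mod q²) provides). Evaluated as a function of the distance, q⁻ⁿ κ ψ c c′ is the
-- number of neighbours of c within distance 1 of c′, as long as c and c′ are not adjacent, which
-- minimum distance 2 excludes. Summed over C this counts the pairs (x, c′) with x a neighbour of
-- a codeword and c′ ∈ C within distance 1 of x, at most |C| n (q − 1) λ by the packing condition.
-- As ψ(n) = n(q − 1)(n(q − 1) + q), cancelling |C| n (q − 1) gives the bound.
module Submission where

open import Defs

module DelsarteBound where

  open import Data.Bool using (true; false; if_then_else_)
  open import Data.Fin using (Fin; zero; suc; punchIn)
  open import Data.Fin.Properties using (_≟_)
  open import Data.Integer as ℤ using (ℤ; +_; -[1+_]; 0ℤ; 1ℤ; _+_; _*_; _-_; -_; _≤_; +≤+)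
  import Data.Integer.Properties as ℤ
  open import Data.Integer.Tactic.RingSolver using (solve-∀)
  open import Data.List using ([]; _∷_; length; lookup)
  open import Data.Nat as ℕ using (ℕ; zero; suc; z≤n; s≤s; _^_; _∸_)
  open import Data.Nat.Divisibility using (_∣_; divides)
  import Data.Nat.Properties as ℕ
  open import Data.Vec using ([]; _∷_; head; tail)
  open import Data.Vec.Functional using (removeAt)
  open import Function using (_∘_)
  open import Relation.Binary.PropositionalEquality
  open import Relation.Nullary using (does; contradiction)
  open import Relation.Nullary.Decidable using (dec-true; yes; no)

  open import Algebra.Properties.CommutativeSemigroup ℤ.+-commutativeSemigroup using (interchange)
  open import Algebra.Properties.Semiring.Sum ℤ.+-*-semiring
    using (sum; sum-syntax; sum-cong-≗; sum-replicate-zero; sum-remove; *-distribˡ-sum; *-distribʳ-sum)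

  sum-+ : ∀ {m} (f g : Fin m → ℤ) → ∑[ i < m ] (f i + g i) ≡ sum f + sum g
  sum-+ {zero}  f g = refl
  sum-+ {suc m} f g = trans (cong (_+_ (f zero + g zero)) (sum-+ (f ∘ suc) (g ∘ suc)))
                            (interchange (f zero) (g zero) (sum (f ∘ suc)) (sum (g ∘ suc)))

  sum-neg : ∀ {m} (f : Fin m → ℤ) → ∑[ i < m ] (- f i) ≡ - sum f
  sum-neg {zero}  f = refl
  sum-neg {suc m} f = trans (cong (_+_ (- f zero)) (sum-neg (f ∘ suc)))
                            (sym (ℤ.neg-distrib-+ (f zero) (sum (f ∘ suc))))

  sum-- : ∀ {m} (f g : Fin m → ℤ) → ∑[ i < m ] (f i - g i) ≡ sum f - sum g
  sum-- f g = trans (sum-+ f (-_ ∘ g)) (cong (_+_ (sum f)) (sum-neg g))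

  sum-const : ∀ m x → ∑[ i < m ] x ≡ + m * x
  sum-const zero    x = sym (ℤ.*-zeroˡ x)
  sum-const (suc m) x = begin
    x + ∑[ i < m ] x      ≡⟨ cong₂ _+_ (sym (ℤ.*-identityˡ x)) (sum-const m x) ⟩
    1ℤ * x + + m * x      ≡⟨ ℤ.*-distribʳ-+ x 1ℤ (+ m) ⟨
    + suc m * x           ∎
    where open ≡-Reasoning

  sum-swap : ∀ {m k} (f : Fin m → Fin k → ℤ) →
             ∑[ i < m ] ∑[ j < k ] f i j ≡ ∑[ j < k ] ∑[ i < m ] f i j
  sum-swap {zero}  {k} f = sym (sum-replicate-zero k)
  sum-swap {suc m}     f = trans (cong (_+_ (sum (f zero))) (sum-swap (f ∘ suc)))
                                 (sym (sum-+ (f zero) _))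

  sum-mono-≤ : ∀ {m} {f g : Fin m → ℤ} → (∀ i → f i ≤ g i) → sum f ≤ sum g
  sum-mono-≤ {zero}  f≤g = ℤ.≤-refl
  sum-mono-≤ {suc m} f≤g = ℤ.+-mono-≤ (f≤g zero) (sum-mono-≤ (f≤g ∘ suc))

  sum-nonNeg : ∀ {m} {f : Fin m → ℤ} → (∀ i → 0ℤ ≤ f i) → 0ℤ ≤ sum f
  sum-nonNeg {m} {f} 0≤f = subst (_≤ sum f) (sum-replicate-zero m) (sum-mono-≤ 0≤f)

  *-distribˡ-sum₂ : ∀ {m k} x (f : Fin m → Fin k → ℤ) →
                    x * ∑[ i < m ] ∑[ j < k ] f i j ≡ ∑[ i < m ] ∑[ j < k ] (x * f i j)
  *-distribˡ-sum₂ x f = trans (*-distribˡ-sum x (sum ∘ f)) (sum-cong-≗ (λ i → *-distribˡ-sum x (f i)))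

  sum-+₂ : ∀ {m k} (f g : Fin m → Fin k → ℤ) →
           ∑[ i < m ] ∑[ j < k ] (f i j + g i j) ≡ ∑[ i < m ] ∑[ j < k ] f i j + ∑[ i < m ] ∑[ j < k ] g i j
  sum-+₂ f g = trans (sum-cong-≗ (λ i → sum-+ (f i) (g i))) (sum-+ (sum ∘ f) (sum ∘ g))

  sum-product : ∀ {m} (α : Fin m → ℤ) c → ∑[ i < m ] ∑[ j < m ] (α i * α j * c) ≡ c * (sum α * sum α)
  sum-product {m} α c = begin
    ∑[ i < m ] ∑[ j < m ] (α i * α j * c)
      ≡⟨ sum-cong-≗ (λ i → sum-cong-≗ (λ j → reorder (α i) (α j) c)) ⟩
    ∑[ i < m ] ∑[ j < m ] (α i * c * α j)
      ≡⟨ sum-cong-≗ (λ i → *-distribˡ-sum (α i * c) α) ⟨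
    ∑[ i < m ] (α i * c * sum α)
      ≡⟨ sum-cong-≗ (λ i → ℤ.*-assoc (α i) c (sum α)) ⟩
    ∑[ i < m ] (α i * (c * sum α))
      ≡⟨ *-distribʳ-sum (c * sum α) α ⟨
    sum α * (c * sum α)
      ≡⟨ reorder′ (sum α) c ⟩
    c * (sum α * sum α) ∎
    where
    open ≡-Reasoning
    reorder : ∀ a b c → a * b * c ≡ a * c * b
    reorder = solve-∀
    reorder′ : ∀ s c → s * (c * s) ≡ c * (s * s)
    reorder′ = solve-∀

  *-nonNeg : ∀ {i j} → 0ℤ ≤ i → 0ℤ ≤ j → 0ℤ ≤ i * j
  *-nonNeg {+ m} {+ k} _ _ = subst (0ℤ ≤_) (ℤ.pos-* m k) (+≤+ z≤n)

  square-nonNeg : ∀ i → 0ℤ ≤ i * i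
  square-nonNeg (+ m)    = *-nonNeg {+ m} {+ m} (+≤+ z≤n) (+≤+ z≤n)
  square-nonNeg -[1+ m ] = +≤+ z≤n

  consecutive-nonNeg : ∀ i → 0ℤ ≤ i * (i + 1ℤ)
  consecutive-nonNeg (+ k)          = *-nonNeg {+ k} {+ k + 1ℤ} (+≤+ z≤n) (+≤+ z≤n)
  consecutive-nonNeg -[1+ zero ]    = +≤+ z≤n
  consecutive-nonNeg -[1+ suc k ]   = +≤+ z≤n

  δ : ∀ {q} → Fin q → Fin q → ℤ
  δ a b = if does (a ≟ b) then 1ℤ else 0ℤ

  δ-sym : ∀ {q} (a b : Fin q) → δ a b ≡ δ b a
  δ-sym zero    zero    = refl
  δ-sym zero    (suc b) = refl
  δ-sym (suc a) zero    = refl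
  δ-sym (suc a) (suc b) = δ-sym a b

  sum-δ : ∀ {q} (a : Fin q) → ∑[ c < q ] δ a c ≡ 1ℤ
  sum-δ {suc q} zero    = cong (_+_ 1ℤ) (sum-replicate-zero q)
  sum-δ {suc q} (suc a) = trans (ℤ.+-identityˡ _) (sum-δ a)

  sum-δ-* : ∀ {q} (a : Fin q) (f : Fin q → ℤ) → ∑[ c < q ] (δ a c * f c) ≡ f a
  sum-δ-* {suc q} zero    f =
    trans (cong₂ _+_ (ℤ.*-identityˡ (f zero)) (sum-replicate-zero q)) (ℤ.+-identityʳ (f zero))
  sum-δ-* {suc q} (suc a) f = trans (ℤ.+-identityˡ _) (sum-δ-* a (f ∘ suc))

  w : ∀ {q} → Fin q → Fin q → ℤ
  w {q} a b = + q * δ a b - 1ℤ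

  sum-w : ∀ {q} (a : Fin q) → ∑[ c < q ] w a c ≡ 0ℤ
  sum-w {q} a = begin
    ∑[ c < q ] (+ q * δ a c - 1ℤ)
      ≡⟨ sum-- (λ c → + q * δ a c) (λ _ → 1ℤ) ⟩
    ∑[ c < q ] (+ q * δ a c) - ∑[ c < q ] 1ℤ
      ≡⟨ cong₂ _-_ (*-distribˡ-sum (+ q) (δ a)) (sym (sum-const q 1ℤ)) ⟨
    + q * sum (δ a) - + q * 1ℤ
      ≡⟨ cong (λ s → + q * s - + q * 1ℤ) (sum-δ a) ⟩
    + q * 1ℤ - + q * 1ℤ
      ≡⟨ ℤ.+-inverseʳ (+ q * 1ℤ) ⟩
    0ℤ ∎
    where open ≡-Reasoning

  sum-w*w : ∀ {q} (a b : Fin q) → ∑[ c < q ] (w a c * w b c) ≡ + q * w a b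
  sum-w*w {q} a b = begin
    ∑[ c < q ] (w a c * w b c)
      ≡⟨ sum-cong-≗ (λ c → expand (+ q) (δ a c) (w b c)) ⟩
    ∑[ c < q ] (+ q * (δ a c * w b c) - w b c)
      ≡⟨ sum-- (λ c → + q * (δ a c * w b c)) (w b) ⟩
    ∑[ c < q ] (+ q * (δ a c * w b c)) - sum (w b)
      ≡⟨ cong₂ _-_ (*-distribˡ-sum (+ q) (λ c → δ a c * w b c)) (sym (sum-w b)) ⟨
    + q * ∑[ c < q ] (δ a c * w b c) - 0ℤ
      ≡⟨ ℤ.+-identityʳ _ ⟩
    + q * ∑[ c < q ] (δ a c * w b c)
      ≡⟨ cong (_*_ (+ q)) (sum-δ-* a (w b)) ⟩
    + q * (+ q * δ b a - 1ℤ)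
      ≡⟨ cong (λ d → + q * (+ q * d - 1ℤ)) (δ-sym b a) ⟩
    + q * w a b ∎
    where
    open ≡-Reasoning
    expand : ∀ Q d v → (Q * d - 1ℤ) * v ≡ Q * (d * v) - v
    expand = solve-∀

  -- κ φ x y = ∑ᵤ φ (n − wt u) χᵤ (x − y) over all characters u of ℤ_qⁿ, split by the first
  -- coordinate of u: if it is 0 then φ shifts, otherwise it contributes ∑_{s ≠ 0} χ_s (a − b) = w a b.
  κ : ∀ {n q} → (ℕ → ℤ) → Word n q → Word n q → ℤ
  κ φ []      []      = φ 0
  κ φ (a ∷ x) (b ∷ y) = κ (φ ∘ suc) x y + w a b * κ φ x y

  κ-nil : ∀ {q} (φ : ℕ → ℤ) (x y : Word 0 q) → κ φ x y ≡ φ 0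
  κ-nil φ [] [] = refl

  κ-cong : ∀ {n q} {φ ψ : ℕ → ℤ} → (∀ t → φ t ≡ ψ t) → (x y : Word n q) → κ φ x y ≡ κ ψ x y
  κ-cong φ≗ψ []      []      = φ≗ψ 0
  κ-cong φ≗ψ (a ∷ x) (b ∷ y) =
    cong₂ (λ u v → u + w a b * v) (κ-cong (φ≗ψ ∘ suc) x y) (κ-cong φ≗ψ x y)

  κ-step : ∀ {n q} (φ : ℕ → ℤ) (x y : Word (suc n) q) α β →
    + q * (α * β * κ φ x y) ≡
    + q * (α * β * κ (φ ∘ suc) (tail x) (tail y)) +
    ∑[ c < q ] (w (head x) c * α * (w (head y) c * β) * κ φ (tail x) (tail y))
  κ-step {q = q} φ (a ∷ x) (b ∷ y) α β = begin
    Q * (α * β * (κ (φ ∘ suc) x y + w a b * k))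
      ≡⟨ split Q α β (κ (φ ∘ suc) x y) (w a b) k ⟩
    Q * (α * β * κ (φ ∘ suc) x y) + α * β * k * (Q * w a b)
      ≡⟨ cong (λ s → Q * (α * β * κ (φ ∘ suc) x y) + α * β * k * s) (sum-w*w a b) ⟨
    Q * (α * β * κ (φ ∘ suc) x y) + α * β * k * ∑[ c < q ] (w a c * w b c)
      ≡⟨ cong (_+_ (Q * (α * β * κ (φ ∘ suc) x y))) (*-distribˡ-sum (α * β * k) (λ c → w a c * w b c)) ⟩
    Q * (α * β * κ (φ ∘ suc) x y) + ∑[ c < q ] (α * β * k * (w a c * w b c))
      ≡⟨ cong (_+_ (Q * (α * β * κ (φ ∘ suc) x y))) (sum-cong-≗ (λ c → regroup α β k (w a c) (w b c))) ⟩
    Q * (α * β * κ (φ ∘ suc) x y) + ∑[ c < q ] (w a c * α * (w b c * β) * k)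
      ∎
    where
    open ≡-Reasoning
    Q = + q
    k = κ φ x y
    split : ∀ Q α β k′ v k → Q * (α * β * (k′ + v * k)) ≡ Q * (α * β * k′) + α * β * k * (Q * v)
    split = solve-∀
    regroup : ∀ α β k u v → α * β * k * (u * v) ≡ u * α * (v * β) * k
    regroup = solve-∀

  kernelForm : ∀ {m n q} → (ℕ → ℤ) → (Fin m → Word n q) → (Fin m → ℤ) → ℤ
  kernelForm {m} φ x α = ∑[ i < m ] ∑[ j < m ] (α i * α j * κ φ (x i) (x j))

  kernelForm-step : ∀ {m n q} (φ : ℕ → ℤ) (x : Fin m → Word (suc n) q) (α : Fin m → ℤ) →
    + q * kernelForm φ x α ≡
    + q * kernelForm (φ ∘ suc) (tail ∘ x) α + ∑[ c < q ] kernelForm φ (tail ∘ x) (λ i → w (head (x i)) c * α i)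
  kernelForm-step {m} {q = q} φ x α = begin
    + q * kernelForm φ x α
      ≡⟨ *-distribˡ-sum₂ (+ q) (λ i j → α i * α j * κ φ (x i) (x j)) ⟩
    ∑[ i < m ] ∑[ j < m ] (+ q * (α i * α j * κ φ (x i) (x j)))
      ≡⟨ sum-cong-≗ (λ i → sum-cong-≗ (λ j → κ-step φ (x i) (x j) (α i) (α j))) ⟩
    ∑[ i < m ] ∑[ j < m ] (+ q * X i j + ∑[ c < q ] Y i j c)
      ≡⟨ sum-+₂ (λ i j → + q * X i j) (λ i j → ∑[ c < q ] Y i j c) ⟩
    ∑[ i < m ] ∑[ j < m ] (+ q * X i j) + ∑[ i < m ] ∑[ j < m ] ∑[ c < q ] Y i j c
      ≡⟨ cong₂ _+_ (*-distribˡ-sum₂ (+ q) X) (sum-cong-≗ (λ i → sum-swap (λ c j → Y i j c))) ⟨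
    + q * kernelForm (φ ∘ suc) (tail ∘ x) α + ∑[ i < m ] ∑[ c < q ] ∑[ j < m ] Y i j c
      ≡⟨ cong (_+_ (+ q * kernelForm (φ ∘ suc) (tail ∘ x) α)) (sum-swap (λ i c → ∑[ j < m ] Y i j c)) ⟩
    + q * kernelForm (φ ∘ suc) (tail ∘ x) α + ∑[ c < q ] ∑[ i < m ] ∑[ j < m ] Y i j c
      ∎
    where
    open ≡-Reasoning
    X : Fin m → Fin m → ℤ
    X i j = α i * α j * κ (φ ∘ suc) (tail (x i)) (tail (x j))
    Y : Fin m → Fin m → Fin q → ℤ
    Y i j c = w (head (x i)) c * α i * (w (head (x j)) c * α j) * κ φ (tail (x i)) (tail (x j))

  -- The trivial character contributes φ n (∑ α)², every other character a nonnegative square.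
  kernelForm-≥ : ∀ {m q′} n (φ : ℕ → ℤ) (x : Fin m → Word n (suc q′)) (α : Fin m → ℤ) →
                 (∀ t → t ℕ.< n → 0ℤ ≤ φ t) → φ n * (sum α * sum α) ≤ kernelForm φ x α
  kernelForm-≥ {m} zero φ x α _ = ℤ.≤-reflexive (begin
    φ 0 * (sum α * sum α)
      ≡⟨ sum-product α (φ 0) ⟨
    ∑[ i < m ] ∑[ j < m ] (α i * α j * φ 0)
      ≡⟨ sum-cong-≗ (λ i → sum-cong-≗ (λ j → cong (_*_ (α i * α j)) (κ-nil φ (x i) (x j)))) ⟨
    kernelForm φ x α ∎)
    where open ≡-Reasoning
  kernelForm-≥ {q′ = q′} (suc n) φ x α φ≥0 = ℤ.*-cancelˡ-≤-pos _ _ Q (begin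
    Q * (φ (suc n) * (sum α * sum α))
      ≤⟨ ℤ.*-monoˡ-≤-nonNeg Q (kernelForm-≥ n (φ ∘ suc) (tail ∘ x) α φ∘suc≥0) ⟩
    Q * kernelForm (φ ∘ suc) (tail ∘ x) α
      ≡⟨ ℤ.+-identityʳ _ ⟨
    Q * kernelForm (φ ∘ suc) (tail ∘ x) α + 0ℤ
      ≤⟨ ℤ.+-monoʳ-≤ (Q * kernelForm (φ ∘ suc) (tail ∘ x) α) (sum-nonNeg (λ c → branch-nonNeg (β c))) ⟩
    Q * kernelForm (φ ∘ suc) (tail ∘ x) α + ∑[ c < suc q′ ] kernelForm φ (tail ∘ x) (β c)
      ≡⟨ kernelForm-step φ x α ⟨
    Q * kernelForm φ x α ∎)
    where
    open ℤ.≤-Reasoning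
    Q = + suc q′
    φ∘suc≥0 : ∀ t → t ℕ.< n → 0ℤ ≤ φ (suc t)
    φ∘suc≥0 t t<n = φ≥0 (suc t) (s≤s t<n)
    β : Fin (suc q′) → Fin _ → ℤ
    β c i = w (head (x i)) c * α i
    branch-nonNeg : ∀ γ → 0ℤ ≤ kernelForm φ (tail ∘ x) γ
    branch-nonNeg γ = ℤ.≤-trans (*-nonNeg (φ≥0 n ℕ.≤-refl) (square-nonNeg (sum γ)))
                                (kernelForm-≥ n φ (tail ∘ x) γ (λ t t<n → φ≥0 t (ℕ.m<n⇒m<1+n t<n)))

  quadratic : ℤ → ℤ → ℤ → ℤ → ℤ
  quadratic A B C t = A * (t * t) + B * t + C

  quadratic-suc : ∀ A B C t → quadratic A B C (1ℤ + t) ≡ quadratic A (A + A + B) (A + B + C) t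
  quadratic-suc A B C t = expand A B C t
    where
    expand : ∀ A B C t → A * ((1ℤ + t) * (1ℤ + t)) + B * (1ℤ + t) + C ≡
                         A * (t * t) + (A + A + B) * t + (A + B + C)
    expand = solve-∀

  -- q² q⁻ⁿ κ (At² + Bt + C) x y as a function of Q = q, N = n and d = hdist x y.
  quadraticKernel : ℤ → ℤ → ℤ → ℤ → ℤ → ℕ → ℤ
  quadraticKernel Q N A B C 0 = A * (Q * N + N * (N - 1ℤ)) + B * Q * N + C * Q * Q
  quadraticKernel Q N A B C 1 = A * (Q + (N - 1ℤ) + (N - 1ℤ)) + B * Q
  quadraticKernel Q N A B C 2 = A + A
  quadraticKernel Q N A B C (suc (suc (suc _))) = 0ℤ

  quadraticKernel-suc : ∀ Q N A B C β d →
    quadraticKernel Q N A (A + A + B) (A + B + C) d +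
    (Q * (if β then 1ℤ else 0ℤ) - 1ℤ) * quadraticKernel Q N A B C d ≡
    Q * quadraticKernel Q (1ℤ + N) A B C ((if β then 0 else 1) ℕ.+ d)
  quadraticKernel-suc Q N A B C true 0 = identity Q N A B C
    where
    identity : ∀ Q N A B C →
      A * (Q * N + N * (N - 1ℤ)) + (A + A + B) * Q * N + (A + B + C) * Q * Q +
      (Q * 1ℤ - 1ℤ) * (A * (Q * N + N * (N - 1ℤ)) + B * Q * N + C * Q * Q) ≡
      Q * (A * (Q * (1ℤ + N) + (1ℤ + N) * (1ℤ + N - 1ℤ)) + B * Q * (1ℤ + N) + C * Q * Q)
    identity = solve-∀
  quadraticKernel-suc Q N A B C true 1 = identity Q N A B C
    where
    identity : ∀ Q N A B C →
      A * (Q + (N - 1ℤ) + (N - 1ℤ)) + (A + A + B) * Q +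
      (Q * 1ℤ - 1ℤ) * (A * (Q + (N - 1ℤ) + (N - 1ℤ)) + B * Q) ≡
      Q * (A * (Q + (1ℤ + N - 1ℤ) + (1ℤ + N - 1ℤ)) + B * Q)
    identity = solve-∀
  quadraticKernel-suc Q N A B C true 2 = identity Q A
    where
    identity : ∀ Q A → A + A + (Q * 1ℤ - 1ℤ) * (A + A) ≡ Q * (A + A)
    identity = solve-∀
  quadraticKernel-suc Q N A B C true (suc (suc (suc _))) = identity Q
    where
    identity : ∀ Q → 0ℤ + (Q * 1ℤ - 1ℤ) * 0ℤ ≡ Q * 0ℤ
    identity = solve-∀
  quadraticKernel-suc Q N A B C false 0 = identity Q N A B C
    where
    identity : ∀ Q N A B C →
      A * (Q * N + N * (N - 1ℤ)) + (A + A + B) * Q * N + (A + B + C) * Q * Q +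
      (Q * 0ℤ - 1ℤ) * (A * (Q * N + N * (N - 1ℤ)) + B * Q * N + C * Q * Q) ≡
      Q * (A * (Q + (1ℤ + N - 1ℤ) + (1ℤ + N - 1ℤ)) + B * Q)
    identity = solve-∀
  quadraticKernel-suc Q N A B C false 1 = identity Q N A B
    where
    identity : ∀ Q N A B →
      A * (Q + (N - 1ℤ) + (N - 1ℤ)) + (A + A + B) * Q +
      (Q * 0ℤ - 1ℤ) * (A * (Q + (N - 1ℤ) + (N - 1ℤ)) + B * Q) ≡
      Q * (A + A)
    identity = solve-∀
  quadraticKernel-suc Q N A B C false 2 = identity Q A
    where
    identity : ∀ Q A → A + A + (Q * 0ℤ - 1ℤ) * (A + A) ≡ Q * 0ℤ
    identity = solve-∀
  quadraticKernel-suc Q N A B C false (suc (suc (suc _))) = identity Q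
    where
    identity : ∀ Q → 0ℤ + (Q * 0ℤ - 1ℤ) * 0ℤ ≡ Q * 0ℤ
    identity = solve-∀

  κ-quadratic : ∀ {n q} A B C (x y : Word n q) →
    + q * + q * κ (quadratic A B C ∘ +_) x y ≡ + (q ^ n) * quadraticKernel (+ q) (+ n) A B C (hdist x y)
  κ-quadratic {q = q} A B C [] [] = base (+ q) A B C
    where
    base : ∀ Q A B C → Q * Q * (A * (0ℤ * 0ℤ) + B * 0ℤ + C) ≡
                       1ℤ * (A * (Q * 0ℤ + 0ℤ * (0ℤ - 1ℤ)) + B * Q * 0ℤ + C * Q * Q)
    base = solve-∀
  κ-quadratic {suc n} {q} A B C (a ∷ x) (b ∷ y) = begin
    Q * Q * (κ (φ ∘ suc) x y + w a b * κ φ x y)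
      ≡⟨ distrib (Q * Q) (κ (φ ∘ suc) x y) (w a b) (κ φ x y) ⟩
    Q * Q * κ (φ ∘ suc) x y + w a b * (Q * Q * κ φ x y)
      ≡⟨ cong₂ (λ u v → u + w a b * v) shifted (κ-quadratic A B C x y) ⟩
    P * quadraticKernel Q (+ n) A (A + A + B) (A + B + C) d + w a b * (P * quadraticKernel Q (+ n) A B C d)
      ≡⟨ factor P _ (w a b) _ ⟩
    P * (quadraticKernel Q (+ n) A (A + A + B) (A + B + C) d + w a b * quadraticKernel Q (+ n) A B C d)
      ≡⟨ cong (_*_ P) (quadraticKernel-suc Q (+ n) A B C (does (a ≟ b)) d) ⟩
    P * (Q * quadraticKernel Q (+ suc n) A B C (hdist (a ∷ x) (b ∷ y)))
      ≡⟨ rotate P Q _ ⟩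
    Q * P * quadraticKernel Q (+ suc n) A B C (hdist (a ∷ x) (b ∷ y))
      ≡⟨ cong (_* quadraticKernel Q (+ suc n) A B C (hdist (a ∷ x) (b ∷ y))) (ℤ.pos-* q (q ^ n)) ⟨
    + (q ^ suc n) * quadraticKernel Q (+ suc n) A B C (hdist (a ∷ x) (b ∷ y))
      ∎
    where
    open ≡-Reasoning
    Q = + q
    P = + (q ^ n)
    d = hdist x y
    φ = quadratic A B C ∘ +_
    shifted : Q * Q * κ (φ ∘ suc) x y ≡ P * quadraticKernel Q (+ n) A (A + A + B) (A + B + C) d
    shifted = trans (cong (_*_ (Q * Q)) (κ-cong (quadratic-suc A B C ∘ +_) x y))
                    (κ-quadratic A (A + A + B) (A + B + C) x y)
    distrib : ∀ K k′ v k → K * (k′ + v * k) ≡ K * k′ + v * (K * k)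
    distrib = solve-∀
    factor : ∀ P k′ v k → P * k′ + v * (P * k) ≡ P * (k′ + v * k)
    factor = solve-∀
    rotate : ∀ P Q k → P * (Q * k) ≡ Q * P * k
    rotate = solve-∀

  neighbourSum : ∀ {n q} → (Word n q → ℤ) → Word n q → ℤ
  neighbourSum f []              = 0ℤ
  neighbourSum {q = q} f (a ∷ x) = (∑[ b < q ] f (b ∷ x) - f (a ∷ x)) + neighbourSum (f ∘ (a ∷_)) x

  sum-except-≤ : ∀ {q′} (t : Fin (suc q′) → ℤ) (a : Fin (suc q′)) k →
                 (∀ b → t b ≤ k) → sum t - t a ≤ + q′ * k
  sum-except-≤ {q′} t a k t≤k = begin
    sum t - t a                            ≡⟨ cong (_- t a) (sum-remove {i = a} t) ⟩
    t a + sum (removeAt t a) - t a         ≡⟨ cancel (t a) (sum (removeAt t a)) ⟩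
    sum (removeAt t a)                     ≤⟨ sum-mono-≤ (λ b → t≤k (punchIn a b)) ⟩
    ∑[ b < q′ ] k                          ≡⟨ sum-const q′ k ⟩
    + q′ * k                               ∎
    where
    open ℤ.≤-Reasoning
    cancel : ∀ u s → u + s - u ≡ s
    cancel = solve-∀

  neighbourSum-≤ : ∀ {n q′} (f : Word n (suc q′) → ℤ) k →
                   (∀ x → f x ≤ k) → ∀ c → neighbourSum f c ≤ + (n ℕ.* q′) * k
  neighbourSum-≤ f k f≤k []                     = ℤ.≤-refl
  neighbourSum-≤ {suc n} {q′} f k f≤k (a ∷ x) = begin
    (sum (λ b → f (b ∷ x)) - f (a ∷ x)) + neighbourSum (f ∘ (a ∷_)) x
      ≤⟨ ℤ.+-mono-≤ (sum-except-≤ (λ b → f (b ∷ x)) a k (λ b → f≤k (b ∷ x)))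
                    (neighbourSum-≤ (f ∘ (a ∷_)) k (λ y → f≤k (a ∷ y)) x) ⟩
    + q′ * k + + (n ℕ.* q′) * k
      ≡⟨ ℤ.*-distribʳ-+ k (+ q′) (+ (n ℕ.* q′)) ⟨
    (+ q′ + + (n ℕ.* q′)) * k
      ≡⟨ cong (_* k) (ℤ.pos-+ q′ (n ℕ.* q′)) ⟨
    + (suc n ℕ.* q′) * k ∎
    where open ℤ.≤-Reasoning

  neighbourSum-cong : ∀ {n q} {f g : Word n q → ℤ} → (∀ x → f x ≡ g x) →
                      ∀ c → neighbourSum f c ≡ neighbourSum g c
  neighbourSum-cong f≗g []      = refl
  neighbourSum-cong f≗g (a ∷ x) = cong₂ _+_ (cong₂ _-_ (sum-cong-≗ (λ b → f≗g (b ∷ x))) (f≗g (a ∷ x)))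
                                            (neighbourSum-cong (f≗g ∘ (a ∷_)) x)

  neighbourSum-sum : ∀ {n q m} (F : Word n q → Fin m → ℤ) (c : Word n q) →
    neighbourSum (λ x → ∑[ j < m ] F x j) c ≡ ∑[ j < m ] neighbourSum (λ x → F x j) c
  neighbourSum-sum {m = m} F [] = sym (sum-replicate-zero m)
  neighbourSum-sum {q = q} {m} F (a ∷ x) = begin
    (∑[ b < q ] ∑[ j < m ] F (b ∷ x) j - ∑[ j < m ] F (a ∷ x) j) + neighbourSum (λ y → ∑[ j < m ] F (a ∷ y) j) x
      ≡⟨ cong₂ _+_ (cong (_- ∑[ j < m ] F (a ∷ x) j) (sum-swap (λ b j → F (b ∷ x) j)))
                   (neighbourSum-sum (F ∘ (a ∷_)) x) ⟩
    (∑[ j < m ] G j - ∑[ j < m ] F (a ∷ x) j) + ∑[ j < m ] H j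
      ≡⟨ cong (_+ ∑[ j < m ] H j) (sum-- G (F (a ∷ x))) ⟨
    ∑[ j < m ] (G j - F (a ∷ x) j) + ∑[ j < m ] H j
      ≡⟨ sum-+ (λ j → G j - F (a ∷ x) j) H ⟨
    ∑[ j < m ] neighbourSum (λ y → F y j) (a ∷ x) ∎
    where
    open ≡-Reasoning
    G H : Fin m → ℤ
    G j = ∑[ b < q ] F (b ∷ x) j
    H j = neighbourSum (λ y → F (a ∷ y) j) x

  -- The neighbours of c lie at distance d − 1, d, d + 1 from c′ in numbers d, d (q − 2) and
  -- (n − d)(q − 1), the intersection numbers of H(n,q); d ∸ 1 only matters when d ≠ 0.
  intersectionSum : ℤ → ℤ → (ℕ → ℤ) → ℕ → ℤ
  intersectionSum Q N χ d = + d * χ (d ∸ 1) + + d * (Q - + 2) * χ d + (N - + d) * (Q - 1ℤ) * χ (suc d)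

  sum-coordinate : ∀ {q} (χ : ℕ → ℤ) (a : Fin q) d →
    ∑[ b < q ] χ ((if does (b ≟ a) then 0 else 1) ℕ.+ d) ≡ χ d + (+ q - 1ℤ) * χ (suc d)
  sum-coordinate {q} χ a d = begin
    ∑[ b < q ] χ ((if does (b ≟ a) then 0 else 1) ℕ.+ d)
      ≡⟨ sum-cong-≗ (λ b → interpolate (does (b ≟ a))) ⟩
    ∑[ b < q ] (χ (suc d) + δ b a * (χ d - χ (suc d)))
      ≡⟨ sum-+ (λ _ → χ (suc d)) (λ b → δ b a * (χ d - χ (suc d))) ⟩
    ∑[ b < q ] χ (suc d) + ∑[ b < q ] (δ b a * (χ d - χ (suc d)))
      ≡⟨ cong₂ _+_ (sum-const q (χ (suc d)))
                   (trans (sum-cong-≗ (λ b → cong (_* (χ d - χ (suc d))) (δ-sym b a))) (sum-δ-* a _)) ⟩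
    + q * χ (suc d) + (χ d - χ (suc d))
      ≡⟨ regroup (+ q) (χ d) (χ (suc d)) ⟩
    χ d + (+ q - 1ℤ) * χ (suc d) ∎
    where
    open ≡-Reasoning
    affine : ∀ u v → u ≡ v + 1ℤ * (u - v)
    affine = solve-∀
    interpolate : ∀ β → χ ((if β then 0 else 1) ℕ.+ d) ≡
                        χ (suc d) + (if β then 1ℤ else 0ℤ) * (χ d - χ (suc d))
    interpolate true  = affine (χ d) (χ (suc d))
    interpolate false = sym (ℤ.+-identityʳ (χ (suc d)))
    regroup : ∀ Q u v → Q * v + (u - v) ≡ u + (Q - 1ℤ) * v
    regroup = solve-∀

  intersectionSum-suc : ∀ Q N (χ : ℕ → ℤ) β d →
    let s = if β then 0 else 1 in
    (χ d + (Q - 1ℤ) * χ (suc d) - χ (s ℕ.+ d)) + intersectionSum Q N (χ ∘ (s ℕ.+_)) d ≡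
    intersectionSum Q (1ℤ + N) χ (s ℕ.+ d)
  intersectionSum-suc Q N χ true d = stay Q N (+ d) (χ (d ∸ 1)) (χ d) (χ (suc d))
    where
    stay : ∀ Q N D x y z →
      (y + (Q - 1ℤ) * z - y) + (D * x + D * (Q - + 2) * y + (N - D) * (Q - 1ℤ) * z) ≡
      D * x + D * (Q - + 2) * y + (1ℤ + N - D) * (Q - 1ℤ) * z
    stay = solve-∀
  intersectionSum-suc Q N χ false d = moveAway d
    where
    move : ∀ Q N D x y z →
      (x + (Q - 1ℤ) * y - y) + (D * x + D * (Q - + 2) * y + (N - D) * (Q - 1ℤ) * z) ≡
      (1ℤ + D) * x + (1ℤ + D) * (Q - + 2) * y + (1ℤ + N - (1ℤ + D)) * (Q - 1ℤ) * z
    move = solve-∀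
    moveAway : ∀ d → (χ d + (Q - 1ℤ) * χ (suc d) - χ (suc d)) + intersectionSum Q N (χ ∘ suc) d ≡
                     intersectionSum Q (1ℤ + N) χ (suc d)
    moveAway zero    = move Q N 0ℤ (χ 0) (χ 1) (χ 2)
    moveAway (suc d) = move Q N (+ suc d) (χ (suc d)) (χ (suc (suc d))) (χ (suc (suc (suc d))))

  neighbourSum-hdist : ∀ {n q} (χ : ℕ → ℤ) (c c′ : Word n q) →
    neighbourSum (λ x → χ (hdist x c′)) c ≡ intersectionSum (+ q) (+ n) χ (hdist c c′)
  neighbourSum-hdist {q = q} χ [] [] = empty (+ q) (χ 0) (χ 1)
    where
    empty : ∀ Q u v → 0ℤ ≡ 0ℤ * u + 0ℤ * (Q - + 2) * u + (0ℤ - 0ℤ) * (Q - 1ℤ) * v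
    empty = solve-∀
  neighbourSum-hdist {suc n} {q} χ (a ∷ x) (a′ ∷ x′) = begin
    (∑[ b < q ] χ (hdist (b ∷ x) (a′ ∷ x′)) - χ (s ℕ.+ d)) + neighbourSum (λ y → χ (s ℕ.+ hdist y x′)) x
      ≡⟨ cong₂ (λ u v → (u - χ (s ℕ.+ d)) + v) (sum-coordinate χ a′ d)
                                                (neighbourSum-hdist (χ ∘ (s ℕ.+_)) x x′) ⟩
    (χ d + (+ q - 1ℤ) * χ (suc d) - χ (s ℕ.+ d)) + intersectionSum (+ q) (+ n) (χ ∘ (s ℕ.+_)) d
      ≡⟨ intersectionSum-suc (+ q) (+ n) χ (does (a ≟ a′)) d ⟩
    intersectionSum (+ q) (+ suc n) χ (s ℕ.+ d) ∎
    where
    open ≡-Reasoning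
    s = if does (a ≟ a′) then 0 else 1
    d = hdist x x′

  ballIndicator : ℕ → ℤ
  ballIndicator 0                   = 1ℤ
  ballIndicator 1                   = 1ℤ
  ballIndicator (suc (suc _))       = 0ℤ

  ballCount-sum : ∀ {n q} (x : Word n q) (C : Code n q) →
                  + ballCount x C ≡ ∑[ j < length C ] ballIndicator (hdist x (lookup C j))
  ballCount-sum x []      = refl
  ballCount-sum x (c ∷ C) with hdist x c
  ... | 0           = cong (_+_ 1ℤ) (ballCount-sum x C)
  ... | 1           = cong (_+_ 1ℤ) (ballCount-sum x C)
  ... | suc (suc _) = trans (ballCount-sum x C) (sym (ℤ.+-identityˡ _))

  sum-intersectionSum-ball : ∀ {n q} (C : Code n q) (c : Word n q) →
    ∑[ j < length C ] intersectionSum (+ q) (+ n) ballIndicator (hdist c (lookup C j)) ≡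
    neighbourSum (λ x → + ballCount x C) c
  sum-intersectionSum-ball {n} {q} C c = begin
    ∑[ j < length C ] intersectionSum (+ q) (+ n) ballIndicator (hdist c (lookup C j))
      ≡⟨ sum-cong-≗ (λ j → neighbourSum-hdist ballIndicator c (lookup C j)) ⟨
    ∑[ j < length C ] neighbourSum (λ x → ballIndicator (hdist x (lookup C j))) c
      ≡⟨ neighbourSum-sum (λ x j → ballIndicator (hdist x (lookup C j))) c ⟨
    neighbourSum (λ x → ∑[ j < length C ] ballIndicator (hdist x (lookup C j))) c
      ≡⟨ neighbourSum-cong (λ x → ballCount-sum x C) c ⟨
    neighbourSum (λ x → + ballCount x C) c ∎
    where open ≡-Reasoning

  -- ψ q n t = (qt − n)(qt − n + q).
  ψ : ℤ → ℤ → ℤ → ℤ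
  ψ Q N = quadratic (Q * Q) (Q * (Q - (N + N))) (N * (N - Q))

  ψ-nonNeg : ∀ Q S t → 0ℤ ≤ ψ Q (Q * S) t
  ψ-nonNeg Q S t = subst (0ℤ ≤_) (sym (factorise Q S t))
                         (*-nonNeg (square-nonNeg Q) (consecutive-nonNeg (t - S)))
    where
    factorise : ∀ Q S t → Q * Q * (t * t) + Q * (Q - (Q * S + Q * S)) * t + Q * S * (Q * S - Q) ≡
                          Q * Q * ((t - S) * (t - S + 1ℤ))
    factorise = solve-∀

  ψ-at-N : ∀ Q N → ψ Q N N ≡ N * (Q - 1ℤ) * (N * (Q - 1ℤ) + Q)
  ψ-at-N Q N = expand Q N
    where
    expand : ∀ Q N → Q * Q * (N * N) + Q * (Q - (N + N)) * N + N * (N - Q) ≡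
                     N * (Q - 1ℤ) * (N * (Q - 1ℤ) + Q)
    expand = solve-∀

  ψ-kernel : ∀ Q N d → d ≢ 1 →
    quadraticKernel Q N (Q * Q) (Q * (Q - (N + N))) (N * (N - Q)) d ≡ Q * Q * intersectionSum Q N ballIndicator d
  ψ-kernel Q N 0 _ = atZero Q N
    where
    atZero : ∀ Q N → Q * Q * (Q * N + N * (N - 1ℤ)) + Q * (Q - (N + N)) * Q * N + N * (N - Q) * Q * Q ≡
                     Q * Q * (0ℤ * 1ℤ + 0ℤ * (Q - + 2) * 1ℤ + (N - 0ℤ) * (Q - 1ℤ) * 1ℤ)
    atZero = solve-∀
  ψ-kernel Q N 1 d≢1 = contradiction refl d≢1
  ψ-kernel Q N 2 _ = atTwo Q N
    where
    atTwo : ∀ Q N → Q * Q + Q * Q ≡ Q * Q * (+ 2 * 1ℤ + + 2 * (Q - + 2) * 0ℤ + (N - + 2) * (Q - 1ℤ) * 0ℤ)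
    atTwo = solve-∀
  ψ-kernel Q N (suc (suc (suc d))) _ = farther Q N (+ suc (suc (suc d)))
    where
    farther : ∀ Q N D → 0ℤ ≡ Q * Q * (D * 0ℤ + D * (Q - + 2) * 0ℤ + (N - D) * (Q - 1ℤ) * 0ℤ)
    farther = solve-∀

  κ-ψ : ∀ {n q′} (x y : Word n (suc q′)) → hdist x y ≢ 1 →
    κ (ψ (+ suc q′) (+ n) ∘ +_) x y ≡
    + (suc q′ ^ n) * intersectionSum (+ suc q′) (+ n) ballIndicator (hdist x y)
  κ-ψ {n} {q′} x y d≢1 = ℤ.*-cancelˡ-≡ (Q * Q) _ _ (begin
    Q * Q * κ (ψ Q N ∘ +_) x y
      ≡⟨ κ-quadratic (Q * Q) (Q * (Q - (N + N))) (N * (N - Q)) x y ⟩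
    P * quadraticKernel Q N (Q * Q) (Q * (Q - (N + N))) (N * (N - Q)) (hdist x y)
      ≡⟨ cong (_*_ P) (ψ-kernel Q N (hdist x y) d≢1) ⟩
    P * (Q * Q * intersectionSum Q N ballIndicator (hdist x y))
      ≡⟨ swap P (Q * Q) _ ⟩
    Q * Q * (P * intersectionSum Q N ballIndicator (hdist x y)) ∎)
    where
    open ≡-Reasoning
    Q = + suc q′
    N = + n
    P = + (suc q′ ^ n)
    swap : ∀ a b c → a * (b * c) ≡ b * (a * c)
    swap = solve-∀

  hdist-refl : ∀ {n q} (x : Word n q) → hdist x x ≡ 0
  hdist-refl []      = refl
  hdist-refl (a ∷ x) rewrite dec-true (a ≟ a) refl = hdist-refl x

  separated⇒hdist≢1 : ∀ {n q} (C : Code n q) →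
    ((i j : Fin (length C)) → i ≢ j → 2 ℕ.≤ hdist (lookup C i) (lookup C j)) →
    ∀ i j → hdist (lookup C i) (lookup C j) ≢ 1
  separated⇒hdist≢1 C separated i j d≡1 with i ≟ j
  ... | yes refl = contradiction (trans (sym (hdist-refl (lookup C i))) d≡1) λ ()
  ... | no i≢j   = contradiction (subst (2 ℕ.≤_) d≡1 (separated i j i≢j)) λ { (s≤s ()) }

  packing-bound : ∀ {n q′} lam (C : Code n (suc q′)) → suc q′ ∣ n → IsPacking lam C →
    (∀ i j → hdist (lookup C i) (lookup C j) ≢ 1) →
    let Θ = + (n ℕ.* q′); M = + length C in
    Θ * (Θ + + suc q′) * (M * M) ≤ + (suc q′ ^ n) * (M * (Θ * + lam))
  packing-bound {n} {q′} lam C (divides s n≡sq) packing separated = begin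
    Θ * (Θ + Q) * (M * M)
      ≡⟨ cong₂ _*_ (trans (ψ-at-N Q N) (cong (λ θ → θ * (θ + Q)) (sym (ℤ.pos-* n q′))))
                   (cong₂ _*_ ones ones) ⟨
    ψ Q N N * (sum 𝟙 * sum 𝟙)
      ≤⟨ kernelForm-≥ n (ψ Q N ∘ +_) c 𝟙 (λ t _ → ψ≥0 t) ⟩
    kernelForm (ψ Q N ∘ +_) c 𝟙
      ≡⟨ sum-cong-≗ (λ i → sum-cong-≗ (λ j →
           trans (ℤ.*-identityˡ _) (κ-ψ (c i) (c j) (separated i j)))) ⟩
    ∑[ i < m ] ∑[ j < m ] (P * I i j)
      ≡⟨ *-distribˡ-sum₂ P I ⟨
    P * ∑[ i < m ] ∑[ j < m ] I i j
      ≡⟨ cong (_*_ P) (sum-cong-≗ (λ i → sum-intersectionSum-ball C (c i))) ⟩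
    P * ∑[ i < m ] neighbourSum (λ x → + ballCount x C) (c i)
      ≤⟨ ℤ.*-monoˡ-≤-nonNeg P (sum-mono-≤ (λ i →
           neighbourSum-≤ _ (+ lam) (λ x → +≤+ (packing x)) (c i))) ⟩
    P * ∑[ i < m ] (Θ * + lam)
      ≡⟨ cong (_*_ P) (sum-const m (Θ * + lam)) ⟩
    P * (M * (Θ * + lam)) ∎
    where
    open ℤ.≤-Reasoning
    m = length C
    c = lookup C
    Q = + suc q′
    N = + n
    Θ = + (n ℕ.* q′)
    M = + m
    P = + (suc q′ ^ n)
    𝟙 : Fin m → ℤ
    𝟙 _ = 1ℤ
    ones : sum 𝟙 ≡ M
    ones = trans (sum-const m 1ℤ) (ℤ.*-identityʳ M)
    N≡Qs : N ≡ Q * + s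
    N≡Qs = trans (cong +_ n≡sq) (trans (ℤ.pos-* s (suc q′)) (ℤ.*-comm (+ s) Q))
    ψ≥0 : ∀ t → 0ℤ ≤ ψ Q N (+ t)
    ψ≥0 t = subst (λ N → 0ℤ ≤ ψ Q N (+ t)) (sym N≡Qs) (ψ-nonNeg Q (+ s) (+ t))
    I : Fin m → Fin m → ℤ
    I i j = intersectionSum Q N ballIndicator (hdist (c i) (c j))

  cancel-bound : ∀ θ q m lam P → 0 ℕ.< θ →
    + θ * (+ θ + + q) * (+ m * + m) ≤ + P * (+ m * (+ θ * + lam)) → m ℕ.* (θ ℕ.+ q) ℕ.≤ lam ℕ.* P
  cancel-bound θ q zero lam P _ _ = z≤n
  cancel-bound (suc θ) q (suc m) lam P _ bound =
    ℤ.drop‿+≤+ (subst₂ _≤_ lhs rhs (ℤ.*-cancelˡ-≤-pos _ _ (+ suc θ * + suc m)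
      (subst₂ _≤_ (regroupˡ (+ suc θ) (+ q) (+ suc m)) (regroupʳ (+ suc θ) (+ suc m) (+ lam) (+ P))
                  bound)))
    where
    regroupˡ : ∀ Θ Q M → Θ * (Θ + Q) * (M * M) ≡ Θ * M * (M * (Θ + Q))
    regroupˡ = solve-∀
    regroupʳ : ∀ Θ M L P → P * (M * (Θ * L)) ≡ Θ * M * (L * P)
    regroupʳ = solve-∀
    lhs : + suc m * (+ suc θ + + q) ≡ + (suc m ℕ.* (suc θ ℕ.+ q))
    lhs = trans (cong (_*_ (+ suc m)) (sym (ℤ.pos-+ (suc θ) q))) (sym (ℤ.pos-* (suc m) (suc θ ℕ.+ q)))
    rhs : + lam * + P ≡ + (lam ℕ.* P)
    rhs = sym (ℤ.pos-* lam P)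

open import Data.List using (length)
open import Data.Nat using (ℕ; suc; z≤n; s≤s; _+_; _*_; _∸_; _^_; _≤_; _<_)
open import Data.Nat.Divisibility using (_∣_; ∣-refl; ∣m∣n⇒∣m+n; ∣n⇒∣m*n; m∣m*n)
open import Data.Product using (∃; _,_)
open import Relation.Binary.PropositionalEquality using (_≡_; subst; sym)
open DelsarteBound using (packing-bound; cancel-bound; separated⇒hdist≢1)

theorem2 : (q n lam : ℕ) → 2 < q → 1 ≤ n
    → (∃ λ k → n ≡ q + k * (q * q))
    → 1 ≤ lam
    → (C : Code n q) → IsPacking lam C → HasMinDist2 C
    → length C * (n * (q ∸ 1) + q) ≤ lam * q ^ n
theorem2 q@(suc q′) n@(suc _) lam (s≤s (s≤s (s≤s _))) _ (k , n≡q+kq²) _ C packing (separated , _) =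
  cancel-bound (n * q′) q (length C) lam (q ^ n) (s≤s z≤n)
    (packing-bound lam C q∣n packing (separated⇒hdist≢1 C separated))
  where
  q∣n : q ∣ n
  q∣n = subst (q ∣_) (sym n≡q+kq²) (∣m∣n⇒∣m+n ∣-refl (∣n⇒∣m*n k (m∣m*n q)))
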